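{- In the persistent data structure described in the context, the space usage of each bottom ST-tree is $O(U\log U)$.
   Context: Model: an ephemeral structure manipulates a memory array $A$ with primitives Read$(i)$ (return $A[i]$) and Write$(i,x)$ (set $A[i]=x$). Writes are numbered $1,2,\dots$; $V$ is the number of Writes so far and $A_v$ the state of $A$ after the $v$-th Write. Persistent-Read$(v,i)$ returns $A_v[i]$. The $v$-th Write, Write$(i,x)$, is represented by the point $(i,v)$ labeled $x$ in the integer grid ($x$-axis memory address, $y$-axis time increasing upward); $P$ is the set of such points. $\log$ is base $2$. ST-trees: each node has an axis-parallel grid rectangle, closed (four-sided) or open (unbounded upward). A node of height $h$ (leaves height $0$) has a rectangle of width $2^h$. Each internal node has a left and right child (half width, side by side) and possibly a third, upper child lying on top of one of them; children's rectangles partition the parent's. A leaf is full iff its rectangle contains a point of $P$; an internal node is full iff it has two full children; a node with three children has a full child; open rectangles are not full. Each leaf stores the at most one point of $P$ in its rectangle and the value $A_v[i]$ for the point $(i,v)$ at the bottom of its rectangle. Global structure: $U$ is the largest memory address written so far rounded up to a power of $2$. The structure keeps $\lceil V/U\rceil$ ST-trees whose root rectangles have width $U$: the $j$-th (bottom) tree has rectangle $[1..U]\times[(j-1)U+1..jU]$ and the last (top) tree has the open rectangle $[1..U]\times[(\lceil V/U\rceil-1)U+1..\infty)$. It also keeps a log of all Writes and an array $C$ of size $U$, where $C[i]$ holds the current $A[i]$ and a pointer to the leaf containing the highest point of $P$ in column $i$. Storage: for a fixed constant $0<\epsilon<1$, the top tree is stored as a complete $3$-ary tree of height $\log U$ (space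 reserved for all potential nodes) in the biased van Emde Boas layout (a tree of height $h$ is split into a top tree of height $\epsilon h$ and $3^{\epsilon h}$ bottom trees of height $(1-\epsilon)h$, each laid out recursively in consecutive memory). A bottom tree is stored contiguously in the same node order but containing only the nodes actually present in it. Write$(i,x)$: if $i>U$, $U$ is doubled and everything is rebuilt by replaying the log; once every $U$ Writes, when the new point lies above the top tree's square, the top tree is compressed into a new bottom tree and a new top tree is created as a complete binary tree (only left/right children) with open rectangles and leaves filled from $C$. Then $C[i]=x$, $V$ is incremented, the point $(i,V)$ is stored in the leaf containing it (reached via $C$) and that leaf is marked full. Reconfiguration: while the parent of the current full node already has three children, the parent is marked full and becomes the current node. For the final node $q$ (whose parent has only two children), every open rectangle in $q$'s subtree is closed by setting its top side to $V$, and a third child is added to $q$'s parent: the root of a new complete binary tree of the same height as $q$, whose open rectangle lies directly on top of $q$'s rectangle and whose leaves are filled with the current values from $C$. -}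

module Defs where

open import Data.Nat using (ℕ; zero; suc; _+_; _*_; _^_; _≤_; _<ᵇ_; _≤ᵇ_; _≡ᵇ_)
open import Data.Bool using (Bool; true; false; if_then_else_)
open import Data.Maybe using (Maybe; just; nothing)
open import Data.Product using (_×_; _,_)
open import Data.List using (List; []; _∷_; _++_; [_]; foldl)

-- Which lower child an upper (third) child lies on top of.
data Side : Set where
  onLeft onRight : Side

-- Axis-parallel grid rectangle of a node:
-- columns [x0 .. x0 + 2^ht - 1], rows [y0 .. top]; yTop = nothing means open
-- (unbounded upward), yTop = just t means closed with top side t.
record Rect : Set where
  constructor rect
  field
    x0   : ℕ
    ht   : ℕ
    y0   : ℕ
    yTop : Maybe ℕ
open Rect public

-- A leaf stores its rectangle, its full mark, the at most one
-- point (i , v , label) of P in it, and the value A_v[i] for its bottom point.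
data ST (Val : Set) : Set where
  leaf : (r : Rect) (full : Bool) (pt : Maybe (ℕ × ℕ × Val)) (val : Val) → ST Val
  node : (r : Rect) (full : Bool) (l rc : ST Val) (up : Maybe (Side × ST Val)) → ST Val

-- Space of a (compactly stored) tree: its number of nodes.
size : {Val : Set} → ST Val → ℕ
size (leaf _ _ _ _) = 1
size (node _ _ l rc nothing) = suc (size l + size rc)
size (node _ _ l rc (just (_ , u))) = suc (size l + size rc + size u)

module _ {Val : Set} where

  rectOf : ST Val → Rect
  rectOf (leaf r _ _ _) = r
  rectOf (node r _ _ _ _) = r

  closeRect : ℕ → Rect → Rect
  closeRect V (rect a h b nothing) = rect a h b (just V)
  closeRect V (rect a h b (just t)) = rect a h b (just t)

  closeAll : ℕ → ST Val → ST Val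
  closeAll V (leaf r f p v) = leaf (closeRect V r) f p v
  closeAll V (node r f l rc nothing) = node (closeRect V r) f (closeAll V l) (closeAll V rc) nothing
  closeAll V (node r f l rc (just (s , u))) =
    node (closeRect V r) f (closeAll V l) (closeAll V rc) (just (s , closeAll V u))

  complete : (ℕ → Val) → (h a b : ℕ) → ST Val
  complete C zero a b = leaf (rect a 0 b nothing) false nothing (C a)
  complete C (suc h) a b =
    node (rect a (suc h) b nothing) false (complete C h a b) (complete C h (a + 2 ^ h) b) nothing

  sideOf : ℕ → ST Val → Side
  sideOf i l = if i <ᵇ x0 (rectOf l) + 2 ^ ht (rectOf l) then onLeft else onRight

  -- result of inserting into a subtree: either the reconfiguration finished
  -- inside it, or its root has just been marked full and the reconfiguration
  -- continues at its parent
  data Res : Set where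
    done   : ST Val → Res
    fullUp : ST Val → Res

  module Insert (V i : ℕ) (x : Val) (C : ℕ → Val) where

    -- third child added on top of the (just closed) full node q
    above : ST Val → ST Val
    above q = complete C (ht (rectOf q)) (x0 (rectOf q)) (suc V)

    finishL : Rect → Bool → Res → ST Val → Res
    finishL r f (done l') rc = done (node r f l' rc nothing)
    finishL r f (fullUp l') rc = done (node r f (closeAll V l') rc (just (onLeft , above l')))

    finishR : Rect → Bool → ST Val → Res → Res
    finishR r f l (done rc') = done (node r f l rc' nothing)
    finishR r f l (fullUp rc') = done (node r f l (closeAll V rc') (just (onRight , above rc')))

    three : Rect → Bool → (ST Val → ST Val) → Res → Res
    three r f rebuild (done c') = done (rebuild c')
    three r f rebuild (fullUp c') = fullUp (rebuild c')

    ins : ST Val → Res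
    ins (leaf r f p v) = fullUp (leaf r true (just (i , V , x)) v)
    ins (node r f l rc nothing) with sideOf i l
    ... | onLeft  = finishL r f (ins l) rc
    ... | onRight = finishR r f l (ins rc)
    ins (node r f l rc (just (onLeft , u))) with sideOf i l
    ... | onLeft  = three r f (λ u' → node r true l rc (just (onLeft , u'))) (ins u)
    ... | onRight = three r f (λ rc' → node r true l rc' (just (onLeft , u))) (ins rc)
    ins (node r f l rc (just (onRight , u))) with sideOf i l
    ... | onLeft  = three r f (λ l' → node r true l' rc (just (onRight , u))) (ins l)
    ... | onRight = three r f (λ u' → node r true l rc (just (onRight , u'))) (ins u)

    -- at the root there is no parent: the root's subtree is closed
    insertTop : ST Val → ST Val
    insertTop t with ins t
    ... | done t' = t'
    ... | fullUp t' = closeAll V t'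

  record State : Set where
    constructor mkState
    field
      logU    : ℕ
      V       : ℕ
      wlog    : List (ℕ × Val)       -- log of all Writes (address , value)
      C       : ℕ → Val              -- current memory contents
      bottoms : List (ST Val)         -- bottom ST-trees, oldest first
      top     : ST Val
      topY0   : ℕ
  open State public

  U : State → ℕ
  U s = 2 ^ logU s

  initial : Val → ℕ → State
  initial d k = mkState k 0 [] (λ _ → d) [] (complete (λ _ → d) k 1 1) 1

  update : (ℕ → Val) → ℕ → Val → (ℕ → Val)
  update C i x j = if j ≡ᵇ i then x else C j

  -- compress the top tree into a bottom tree when the new point lies above it
  compressIfNeeded : State → State
  compressIfNeeded s =
    if topY0 s + U s ≤ᵇ suc (V s)
    then record s { bottoms = bottoms s ++ [ closeAll (V s) (top s) ]
                  ; top = complete (C s) (logU s) 1 (suc (V s))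
                  ; topY0 = suc (V s) }
    else s

  -- Write(i , x) when i ≤ U
  stepFixed : State → ℕ × Val → State
  stepFixed s (i , x) =
    record s1 { V = suc (V s1)
              ; wlog = wlog s1 ++ [ (i , x) ]
              ; C = update (C s1) i x
              ; top = Insert.insertTop (suc (V s1)) i x (update (C s1) i x) (top s1) }
    where s1 = compressIfNeeded s

  replay : Val → ℕ → List (ℕ × Val) → State
  replay d k ws = foldl stepFixed (initial d k) ws

  -- double U (increase k) until i ≤ 2 ^ k  (fuel i suffices)
  grow : (i fuel k : ℕ) → ℕ
  grow i zero k = k
  grow i (suc f) k = if i ≤ᵇ 2 ^ k then k else grow i f (suc k)

  write : Val → State → ℕ × Val → State
  write d s (i , x) =
    if U s <ᵇ i
    then stepFixed (replay d (grow i i (logU s)) (wlog s)) (i , x)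
    else stepFixed s (i , x)

  run : Val → List (ℕ × Val) → State
  run d ws = foldl (write d) (initial d 0) ws

-- A bottom tree is a closed top tree, so it suffices to bound the size of the top
-- tree.  An upper child of height h is only ever created on top of a full node of
-- height h, which holds at least 2 ^ h points.  Charging the upper child's fewer than
-- 2 · 2 ^ h nodes to those points shows by induction that a tree of height h holding
-- p points has fewer than 2 (2 ^ h + h p) nodes.  The top tree holds one point per
-- Write since its creation and is compressed after U Writes, so it never holds more
-- than U points, and every bottom tree has fewer than 2 (U + U log U) nodes.
module Submission where

open import Defs
open import Data.Nat using (ℕ; _≤_; _*_)
open import Data.Product using (Σ; _×_; proj₁)
open import Data.List using (List)
open import Data.List.Relation.Unary.All using (All)

open import Data.Bool using (true; false; T)
open import Data.List using ([]; _∷_; foldl)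
open import Data.List.Relation.Unary.All using ([]; map)
open import Data.List.Relation.Unary.All.Properties using (∷ʳ⁺)
open import Data.Maybe using (just; nothing)
open import Data.Nat using (zero; suc; _+_; _^_; _<_; _≤ᵇ_; _<ᵇ_; z≤n; s≤s)
open import Data.Nat.Properties
open import Data.Nat.Tactic.RingSolver using (solve-∀)
open import Algebra.Properties.CommutativeSemigroup +-commutativeSemigroup
  using (xy∙z≈y∙xz; xy∙z≈z∙xy; xy∙z≈xz∙y)
open import Data.Product using (_,_; proj₂)
open import Relation.Binary.PropositionalEquality
  using (_≡_; refl; sym; trans; cong; cong₂; subst; module ≡-Reasoning)

binary-budget : ∀ S h P Q →
                2 * (S + h * P) + 2 * (S + h * Q) ≡ 2 * (2 * S + h * (P + Q))
binary-budget = solve-∀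

ternary-nodes : ∀ a b c → 3 + (a + b + c) ≡ suc a + suc b + suc c
ternary-nodes = solve-∀

ternary-budget : ∀ S h P Q R →
                 2 * (S + h * P) + 2 * (S + h * Q) + 2 * (S + h * R) ≡
                 2 * (S + (2 * S + h * (P + Q + R)))
ternary-budget = solve-∀

height-budget : ∀ S h N → 2 * (N + (2 * S + h * N)) ≡ 2 * (2 * S + suc h * N)
height-budget = solve-∀

budget-split : ∀ S k → 2 * (S + suc k * S) + 2 * k * S ≡ 4 * S * suc k
budget-split = solve-∀

budget-≤-4kU : ∀ k → 2 ≤ 2 ^ k → 2 * (2 ^ k + k * 2 ^ k) ≤ 4 * 2 ^ k * k
budget-≤-4kU zero    (s≤s ())
budget-≤-4kU (suc k) _ =
  ≤-trans (m≤m+n _ (2 * k * 2 ^ suc k)) (≤-reflexive (budget-split (2 ^ suc k) k))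

foldl-preserves : ∀ {A B : Set} (P : A → Set) {f : A → B → A} →
                  (∀ a b → P a → P (f a b)) → ∀ {a} bs → P a → P (foldl f a bs)
foldl-preserves P pres []       Pa = Pa
foldl-preserves P pres (b ∷ bs) Pa = foldl-preserves P pres bs (pres _ b Pa)

module _ {Val : Set} where

  points : ST Val → ℕ
  points (leaf _ _ nothing _)           = 0
  points (leaf _ _ (just _) _)          = 1
  points (node _ _ l rc nothing)        = points l + points rc
  points (node _ _ l rc (just (_ , u))) = points l + points rc + points u

  beneath : Side → ST Val → ST Val → ST Val
  beneath onLeft  l rc = l
  beneath onRight l rc = rc

  data WellFormed : ℕ → ST Val → Set where
    wf-leaf    : ∀ {r f p v} → ht r ≡ 0 → WellFormed 0 (leaf r f p v)
    wf-binary  : ∀ {h r f l rc} → ht r ≡ suc h →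
                 WellFormed h l → WellFormed h rc →
                 WellFormed (suc h) (node r f l rc nothing)
    wf-ternary : ∀ {h r f l rc u} s → ht r ≡ suc h →
                 WellFormed h l → WellFormed h rc → WellFormed h u →
                 2 ^ h ≤ points (beneath s l rc) →
                 WellFormed (suc h) (node r f l rc (just (s , u)))

  ht-wf : ∀ {h t} → WellFormed h t → ht (rectOf t) ≡ h
  ht-wf (wf-leaf e)              = e
  ht-wf (wf-binary e _ _)        = e
  ht-wf (wf-ternary _ e _ _ _ _) = e

  points-beneath-≤ : ∀ s l rc u → points (beneath s l rc) ≤ points l + points rc + points u
  points-beneath-≤ onLeft  l rc u = ≤-trans (m≤m+n (points l) (points rc)) (m≤m+n _ (points u))
  points-beneath-≤ onRight l rc u = ≤-trans (m≤n+m (points rc) (points l)) (m≤m+n _ (points u))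

  size-bound : ∀ {h t} → WellFormed h t → suc (size t) ≤ 2 * (2 ^ h + h * points t)
  size-bound (wf-leaf _) = ≤-refl
  size-bound (wf-binary {h} {l = l} {rc = rc} _ wl wr) = begin
    suc (suc (size l + size rc))       ≡⟨ cong suc (+-suc (size l) (size rc)) ⟨
    suc (size l) + suc (size rc)       ≤⟨ +-mono-≤ (size-bound wl) (size-bound wr) ⟩
    2 * (S + h * P) + 2 * (S + h * Q)  ≡⟨ binary-budget S h P Q ⟩
    2 * (2 * S + h * (P + Q))
      ≤⟨ *-monoʳ-≤ 2 (+-monoʳ-≤ (2 * S) (*-monoˡ-≤ (P + Q) (n≤1+n h))) ⟩
    2 * (2 * S + suc h * (P + Q))      ∎
    where
    open ≤-Reasoning
    S = 2 ^ h
    P = points l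
    Q = points rc
  size-bound (wf-ternary {h} {l = l} {rc = rc} {u = u} s _ wl wr wu loaded) = begin
    suc (suc (size l + size rc + size u))                ≤⟨ n≤1+n _ ⟩
    3 + (size l + size rc + size u)                      ≡⟨ ternary-nodes _ _ _ ⟩
    suc (size l) + suc (size rc) + suc (size u)
      ≤⟨ +-mono-≤ (+-mono-≤ (size-bound wl) (size-bound wr)) (size-bound wu) ⟩
    2 * (S + h * P) + 2 * (S + h * Q) + 2 * (S + h * R)  ≡⟨ ternary-budget S h P Q R ⟩
    2 * (S + (2 * S + h * N))
      ≤⟨ *-monoʳ-≤ 2 (+-monoˡ-≤ _ (≤-trans loaded (points-beneath-≤ s l rc u))) ⟩
    2 * (N + (2 * S + h * N))                            ≡⟨ height-budget S h N ⟩
    2 * (2 * S + suc h * N)                              ∎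
    where
    open ≤-Reasoning
    S = 2 ^ h
    P = points l
    Q = points rc
    R = points u
    N = P + Q + R

  ht-closeRect : ∀ V r → ht (closeRect {Val} V r) ≡ ht r
  ht-closeRect V (rect _ _ _ nothing)  = refl
  ht-closeRect V (rect _ _ _ (just _)) = refl

  points-closeAll : ∀ V t → points (closeAll V t) ≡ points t
  points-closeAll V (leaf _ _ nothing _)  = refl
  points-closeAll V (leaf _ _ (just _) _) = refl
  points-closeAll V (node _ _ l rc nothing) =
    cong₂ _+_ (points-closeAll V l) (points-closeAll V rc)
  points-closeAll V (node _ _ l rc (just (_ , u))) =
    cong₂ _+_ (cong₂ _+_ (points-closeAll V l) (points-closeAll V rc)) (points-closeAll V u)

  size-closeAll : ∀ V (t : ST Val) → size (closeAll V t) ≡ size t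
  size-closeAll V (leaf _ _ _ _) = refl
  size-closeAll V (node _ _ l rc nothing) =
    cong suc (cong₂ _+_ (size-closeAll V l) (size-closeAll V rc))
  size-closeAll V (node _ _ l rc (just (_ , u))) =
    cong suc (cong₂ _+_ (cong₂ _+_ (size-closeAll V l) (size-closeAll V rc)) (size-closeAll V u))

  closeAll-full : ∀ V q {n} → n ≤ points q → n ≤ points (closeAll V q)
  closeAll-full V q {n} = subst (n ≤_) (sym (points-closeAll V q))

  beneath-closeAll : ∀ V s l rc →
                     beneath s (closeAll V l) (closeAll V rc) ≡ closeAll V (beneath s l rc)
  beneath-closeAll V onLeft  l rc = refl
  beneath-closeAll V onRight l rc = refl

  closeAll-wf : ∀ V {h t} → WellFormed h t → WellFormed h (closeAll V t)
  closeAll-wf V (wf-leaf {r = r} e) = wf-leaf (trans (ht-closeRect V r) e)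
  closeAll-wf V (wf-binary {r = r} e wl wr) =
    wf-binary (trans (ht-closeRect V r) e) (closeAll-wf V wl) (closeAll-wf V wr)
  closeAll-wf V (wf-ternary {r = r} {l = l} {rc = rc} s e wl wr wu loaded) =
    wf-ternary s (trans (ht-closeRect V r) e)
      (closeAll-wf V wl) (closeAll-wf V wr) (closeAll-wf V wu)
      (subst (λ q → _ ≤ points q) (sym (beneath-closeAll V s l rc))
        (closeAll-full V (beneath s l rc) loaded))

  points-complete : ∀ C h a b → points (complete C h a b) ≡ 0
  points-complete C zero    a b = refl
  points-complete C (suc h) a b =
    cong₂ _+_ (points-complete C h a b) (points-complete C h (a + 2 ^ h) b)

  complete-wf : ∀ C h a b → WellFormed h (complete C h a b)
  complete-wf C zero    a b = wf-leaf refl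
  complete-wf C (suc h) a b =
    wf-binary refl (complete-wf C h a b) (complete-wf C h (a + 2 ^ h) b)

  replace-points-≤ : ∀ {K c c'} (rebuild : ST Val → ST Val) →
                     (∀ t → points (rebuild t) ≡ points t + K) →
                     points c' ≤ suc (points c) → points (rebuild c') ≤ suc (points (rebuild c))
  replace-points-≤ {K} {c} {c'} rebuild split le = begin
    points (rebuild c')      ≡⟨ split c' ⟩
    points c' + K            ≤⟨ +-monoˡ-≤ K le ⟩
    suc (points c + K)       ≡⟨ cong suc (split c) ⟨
    suc (points (rebuild c)) ∎
    where open ≤-Reasoning

  module _ (V i : ℕ) (x : Val) (C : ℕ → Val) where
    open Insert V i x C

    data Inserted (h p : ℕ) : Res → Set where
      done-ok   : ∀ {t} → WellFormed h t → points t ≤ suc p → Inserted h p (done t)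
      fullUp-ok : ∀ {t} → WellFormed h t → points t ≤ suc p → 2 ^ h ≤ points t →
                  Inserted h p (fullUp t)

    above-wf : ∀ {h q} → WellFormed h q → WellFormed h (above q)
    above-wf {q = q} wq = subst (λ h → WellFormed h (above q)) (ht-wf wq)
      (complete-wf C (ht (rectOf q)) (x0 (rectOf q)) (suc V))

    points-closeAll-above : ∀ q → points (closeAll V q) + points (above q) ≡ points q
    points-closeAll-above q = begin
      points (closeAll V q) + points (above q)
        ≡⟨ cong₂ _+_ (points-closeAll V q)
                     (points-complete C (ht (rectOf q)) (x0 (rectOf q)) (suc V)) ⟩
      points q + 0 ≡⟨ +-identityʳ (points q) ⟩
      points q     ∎
      where open ≡-Reasoning

    finishL-ok : ∀ {h r f l rc res} → ht r ≡ suc h →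
                 Inserted h (points l) res → WellFormed h rc →
                 Inserted (suc h) (points l + points rc) (finishL r f res rc)
    finishL-ok {rc = rc} e (done-ok wl' le) wr =
      done-ok (wf-binary e wl' wr) (+-monoˡ-≤ (points rc) le)
    finishL-ok {l = l} {rc = rc} e (fullUp-ok {l'} wl' le full) wr =
      done-ok (wf-ternary onLeft e (closeAll-wf V wl') wr (above-wf wl')
                 (closeAll-full V l' full))
        (begin
          points (closeAll V l') + points rc + points (above l')
            ≡⟨ xy∙z≈xz∙y (points (closeAll V l')) _ _ ⟩
          points (closeAll V l') + points (above l') + points rc
            ≡⟨ cong (_+ points rc) (points-closeAll-above l') ⟩
          points l' + points rc       ≤⟨ +-monoˡ-≤ (points rc) le ⟩
          suc (points l + points rc)  ∎)
      where open ≤-Reasoning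

    finishR-ok : ∀ {h r f l rc res} → ht r ≡ suc h →
                 WellFormed h l → Inserted h (points rc) res →
                 Inserted (suc h) (points l + points rc) (finishR r f l res)
    finishR-ok {l = l} {rc = rc} e wl (done-ok wr' le) =
      done-ok (wf-binary e wl wr')
        (≤-trans (+-monoʳ-≤ (points l) le) (≤-reflexive (+-suc (points l) (points rc))))
    finishR-ok {l = l} {rc = rc} e wl (fullUp-ok {rc'} wr' le full) =
      done-ok (wf-ternary onRight e wl (closeAll-wf V wr') (above-wf wr')
                 (closeAll-full V rc' full))
        (begin
          points l + points (closeAll V rc') + points (above rc')
            ≡⟨ +-assoc (points l) _ _ ⟩
          points l + (points (closeAll V rc') + points (above rc'))
            ≡⟨ cong (points l +_) (points-closeAll-above rc') ⟩
          points l + points rc'       ≤⟨ +-monoʳ-≤ (points l) le ⟩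
          points l + suc (points rc)  ≡⟨ +-suc (points l) (points rc) ⟩
          suc (points l + points rc)  ∎)
      where open ≤-Reasoning

    -- K counts the points of the two children that are left untouched; the full
    -- child beneath the upper child is one of them.
    three-ok : ∀ {h K res} r f (rebuild : ST Val → ST Val) c →
               (∀ {c'} → WellFormed h c' → WellFormed (suc h) (rebuild c')) →
               (∀ c' → points (rebuild c') ≡ points c' + K) → 2 ^ h ≤ K →
               Inserted h (points c) res →
               Inserted (suc h) (points (rebuild c)) (three r f rebuild res)
    three-ok r f rebuild c wf-rebuild split loaded (done-ok wc' le) =
      done-ok (wf-rebuild wc') (replace-points-≤ rebuild split le)
    three-ok {h} {K} r f rebuild c wf-rebuild split loaded (fullUp-ok {c'} wc' le full) =
      fullUp-ok (wf-rebuild wc') (replace-points-≤ rebuild split le) (begin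
        2 ^ h + (2 ^ h + 0) ≡⟨ cong (2 ^ h +_) (+-identityʳ (2 ^ h)) ⟩
        2 ^ h + 2 ^ h       ≤⟨ +-mono-≤ full loaded ⟩
        points c' + K       ≡⟨ split c' ⟨
        points (rebuild c') ∎)
      where open ≤-Reasoning

    ins-ok : ∀ {h} t → WellFormed h t → Inserted h (points t) (ins t)
    ins-ok (leaf r f p v) (wf-leaf e) = fullUp-ok (wf-leaf e) (s≤s z≤n) (s≤s z≤n)
    ins-ok (node r f l rc nothing) (wf-binary e wl wr) with sideOf i l
    ... | onLeft  = finishL-ok {l = l} e (ins-ok l wl) wr
    ... | onRight = finishR-ok {rc = rc} e wl (ins-ok rc wr)
    ins-ok (node r f l rc (just (onLeft , u))) (wf-ternary onLeft e wl wr wu loaded)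
      with sideOf i l
    ... | onLeft  = three-ok r f _ u (λ wu' → wf-ternary onLeft e wl wr wu' loaded)
                      (λ u' → xy∙z≈z∙xy (points l) (points rc) (points u'))
                      (≤-trans loaded (m≤m+n _ _)) (ins-ok u wu)
    ... | onRight = three-ok r f _ rc (λ wr' → wf-ternary onLeft e wl wr' wu loaded)
                      (λ rc' → xy∙z≈y∙xz (points l) (points rc') (points u))
                      (≤-trans loaded (m≤m+n _ _)) (ins-ok rc wr)
    ins-ok (node r f l rc (just (onRight , u))) (wf-ternary onRight e wl wr wu loaded)
      with sideOf i l
    ... | onLeft  = three-ok r f _ l (λ wl' → wf-ternary onRight e wl' wr wu loaded)
                      (λ l' → +-assoc (points l') (points rc) (points u))
                      (≤-trans loaded (m≤m+n _ _)) (ins-ok l wl)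
    ... | onRight = three-ok r f _ u (λ wu' → wf-ternary onRight e wl wr wu' loaded)
                      (λ u' → xy∙z≈z∙xy (points l) (points rc) (points u'))
                      (≤-trans loaded (m≤n+m _ _)) (ins-ok u wu)

    insertTop-ok : ∀ {h} t → WellFormed h t →
                   WellFormed h (insertTop t) × points (insertTop t) ≤ suc (points t)
    insertTop-ok t wt with ins t | ins-ok t wt
    ... | done t'   | done-ok wt' le     = wt' , le
    ... | fullUp t' | fullUp-ok wt' le _ =
      closeAll-wf V wt' , subst (_≤ suc (points t)) (sym (points-closeAll V t')) le

  -- The points of the top tree are the Writes numbered topY0 s, …, V s.
  record Invariant (slack : ℕ) (s : State {Val}) : Set where
    field
      top-wf        : WellFormed (logU s) (top s)
      top-points    : points (top s) + topY0 s ≤ suc (V s)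
      top-room      : slack + V s < topY0 s + U s
      bottoms-small : All (λ t → suc (size t) ≤ 2 * (U s + logU s * U s)) (bottoms s)

  points-top-≤-U : ∀ {s} → Invariant 0 s → points (top s) ≤ U s
  points-top-≤-U {s} I = +-cancelʳ-≤ (topY0 s) (points (top s)) (U s) (begin
    points (top s) + topY0 s ≤⟨ top-points ⟩
    suc (V s)                ≤⟨ top-room ⟩
    topY0 s + U s            ≡⟨ +-comm (topY0 s) (U s) ⟩
    U s + topY0 s            ∎)
    where
    open Invariant I
    open ≤-Reasoning

  closed-top-small : ∀ {s} → Invariant 0 s →
                     suc (size (closeAll (V s) (top s))) ≤ 2 * (U s + logU s * U s)
  closed-top-small {s} I = begin
    suc (size (closeAll (V s) (top s))) ≡⟨ cong suc (size-closeAll (V s) (top s)) ⟩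
    suc (size (top s))                  ≤⟨ size-bound (Invariant.top-wf I) ⟩
    2 * (U s + logU s * points (top s))
      ≤⟨ *-monoʳ-≤ 2 (+-monoʳ-≤ (U s) (*-monoʳ-≤ (logU s) (points-top-≤-U I))) ⟩
    2 * (U s + logU s * U s)            ∎
    where open ≤-Reasoning

  compress-ok : ∀ s → Invariant 0 s → Invariant 1 (compressIfNeeded s)
  compress-ok s I with topY0 s + U s ≤ᵇ suc (V s) in expired
  ... | true = record
    { top-wf        = complete-wf (C s) (logU s) 1 (suc (V s))
    ; top-points    = ≤-reflexive (cong (_+ suc (V s)) (points-complete (C s) (logU s) 1 (suc (V s))))
    ; top-room      = m<m+n (suc (V s)) (m^n>0 2 (logU s))
    ; bottoms-small = ∷ʳ⁺ bottoms-small (closed-top-small I)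
    }
    where open Invariant I
  ... | false = record
    { top-wf        = top-wf
    ; top-points    = top-points
    ; top-room      = ≰⇒> (λ le → subst T expired (≤⇒≤ᵇ le))
    ; bottoms-small = bottoms-small
    }
    where open Invariant I

  stepFixed-ok : ∀ s w → Invariant 0 s → Invariant 0 (stepFixed s w)
  stepFixed-ok s (i , x) I = record
    { top-wf        = proj₁ inserted
    ; top-points    = ≤-trans (+-monoˡ-≤ (topY0 s₁) (proj₂ inserted)) (s≤s top-points)
    ; top-room      = top-room
    ; bottoms-small = bottoms-small
    }
    where
    s₁ = compressIfNeeded s
    open Invariant (compress-ok s I)
    inserted = insertTop-ok (suc (V s₁)) i x (update (C s₁) i x) (top s₁) top-wf

  initial-ok : ∀ d k → Invariant 0 (initial d k)
  initial-ok d k = record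
    { top-wf        = complete-wf (λ _ → d) k 1 1
    ; top-points    = ≤-reflexive (cong (_+ 1) (points-complete (λ _ → d) k 1 1))
    ; top-room      = s≤s z≤n
    ; bottoms-small = []
    }

  write-ok : ∀ d s w → Invariant 0 s → Invariant 0 (write d s w)
  write-ok d s (i , x) I with U s <ᵇ i
  ... | true  = stepFixed-ok _ (i , x)
                  (foldl-preserves (Invariant 0) stepFixed-ok (wlog s) (initial-ok d _))
  ... | false = stepFixed-ok s (i , x) I

  run-ok : ∀ d ws → Invariant 0 (run d ws)
  run-ok d ws = foldl-preserves (Invariant 0) (write-ok d) ws (initial-ok d 0)

lemma4 : Σ ℕ λ c → Σ ℕ λ n₀ →
           (Val : Set) (d : Val) (ws : List (ℕ × Val)) →
           All (λ w → 1 ≤ proj₁ w) ws →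
           n₀ ≤ U (run d ws) →
           All (λ t → size t ≤ c * U (run d ws) * logU (run d ws)) (bottoms (run d ws))
lemma4 = 4 , 2 , λ Val d ws _ 2≤U →
  map (λ small → ≤-trans (<⇒≤ small) (budget-≤-4kU (logU (run d ws)) 2≤U))
      (Invariant.bottoms-small (run-ok d ws))
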